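{- Let $G=(V,E)$ be a finite simple graph. The Wavefront algorithm (described in the context) applied to $G$ returns the zero forcing number $Z(G)$.
   Context: For $v\in V$, $N(v)$ is the neighborhood of $v$ and $N[v]=N(v)\cup\{v\}$; $n=|V|$. Zero forcing color change rule: a colored vertex with exactly one uncolored neighbor forces that neighbor to become colored. The closure $\mathrm{cl}(S)$ of $S\subseteq V$ is the set of colored vertices obtained from $S$ by applying the rule until no further vertex can be forced. A zero forcing set is a set $S$ with $\mathrm{cl}(S)=V$, and $Z(G)$ is the minimum cardinality of a zero forcing set. Wavefront algorithm: initialize $\mathcal{C}\leftarrow\{(\emptyset,0)\}$. For $R=1,2,\dots,n$: for each $(S,r)\in\mathcal{C}$: for each $v\in V$: set $S'\leftarrow \mathrm{cl}(S\cup N[v])$ and $r'\leftarrow r+|\{v\}\setminus S|+\max\{|N(v)\setminus S|-1,0\}$; if $r'\le R$ and there is no pair $(S',i)\in\mathcal{C}$ with $i\le R$, then add $(S',r')$ to $\mathcal{C}$, and if moreover $S'=V$, return $r'$. -}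

module Defs where

open import Data.Nat using (ℕ; zero; suc; _+_; _∸_; _≤_; _≤ᵇ_; _≡ᵇ_)
open import Data.Bool using (Bool; true; false; _∧_; _∨_; not; if_then_else_)
import Data.Bool as B
open import Data.Fin using (Fin)
open import Data.Fin.Subset using (Subset; ⊤; ⊥; _∪_; _─_; ∣_∣; ⁅_⁆)
open import Data.Vec using (tabulate; lookup)
open import Data.Vec.Properties using (≡-dec)
open import Data.List using (List; []; _∷_; _++_; [_]; allFin)
open import Data.Bool.ListAction using (any)
open import Data.Maybe using (Maybe; just; nothing)
open import Data.Product using (Σ; _×_; _,_; proj₁; proj₂)
open import Data.Sum using (_⊎_; inj₁; inj₂)
open import Relation.Nullary.Decidable using (⌊_⌋)
open import Relation.Binary.PropositionalEquality using (_≡_)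

record Graph (n : ℕ) : Set where
  field
    adj    : Fin n → Fin n → Bool
    sym    : ∀ u v → adj u v ≡ adj v u
    irrefl : ∀ v → adj v v ≡ false

iter : {A : Set} → ℕ → (A → A) → A → A
iter zero    f a = a
iter (suc k) f a = f (iter k f a)

_=ˢ_ : ∀ {n} → Subset n → Subset n → Bool
S =ˢ T = ⌊ ≡-dec B._≟_ S T ⌋

forEach : {A C : Set} → List A → (A → C → C ⊎ ℕ) → C → C ⊎ ℕ
forEach []       f c = inj₁ c
forEach (x ∷ xs) f c with f x c
... | inj₁ c' = forEach xs f c'
... | inj₂ r  = inj₂ r

module _ {n : ℕ} (G : Graph n) where
  open Graph G

  N : Fin n → Subset n
  N v = tabulate (λ u → adj v u)

  N[_] : Fin n → Subset n
  N[ v ] = N v ∪ ⁅ v ⁆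

  -- one round of the color change rule: u becomes colored if some colored v
  -- has exactly one uncolored neighbour, namely u.
  forceStep : Subset n → Subset n
  forceStep S = tabulate (λ u → lookup S u ∨
    any (λ v → lookup S v ∧ (∣ N v ─ S ∣ ≡ᵇ 1) ∧ lookup (N v ─ S) u) (allFin n))

  -- closure: apply the rule until nothing more can be forced
  -- (each non-stationary round colors ≥ 1 new vertex, so n rounds suffice)
  cl : Subset n → Subset n
  cl S = iter n forceStep S

  IsZeroForcingSet : Subset n → Set
  IsZeroForcingSet S = cl S ≡ ⊤

  IsZeroForcingNumber : ℕ → Set
  IsZeroForcingNumber k =
    (Σ (Subset n) λ S → IsZeroForcingSet S × ∣ S ∣ ≡ k) ×
    (∀ S → IsZeroForcingSet S → k ≤ ∣ S ∣)

  Pairs : Set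
  Pairs = List (Subset n × ℕ)

  -- body of the innermost loop for given R, (S , r) ∈ C and v ∈ V
  wfStep : ℕ → Subset n × ℕ → Fin n → Pairs → Pairs ⊎ ℕ
  wfStep R (S , r) v C =
    let S' = cl (S ∪ N[ v ])
        r' = r + ∣ ⁅ v ⁆ ─ S ∣ + (∣ N v ─ S ∣ ∸ 1)
    in if (r' ≤ᵇ R) ∧ not (any (λ p → (proj₁ p =ˢ S') ∧ (proj₂ p ≤ᵇ R)) C)
       then (if S' =ˢ ⊤ then inj₂ r' else inj₁ (C ++ [ (S' , r') ]))
       else inj₁ C

  -- one value of R: iterate over the pairs of C present at the start of the round
  wfRound : ℕ → Pairs → Pairs ⊎ ℕ
  wfRound R C = forEach C (λ p → forEach (allFin n) (wfStep R p)) C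

  -- R runs over 1, 2, …, n (fuel = number of remaining values of R)
  wfLoop : ℕ → ℕ → Pairs → Maybe ℕ
  wfLoop zero    R C = nothing
  wfLoop (suc k) R C with wfRound R C
  ... | inj₂ r  = just r
  ... | inj₁ C' = wfLoop k (suc R) C'

  wavefront : Maybe ℕ
  wavefront = wfLoop n 1 [ (⊥ , 0) ]

module Submission where

-- The algorithm explores states S ⊆ V with budgets r, moving from (S , r) via a vertex v
-- to (cl (S ∪ N[v]) , r + |{v} ∖ S| + max(|N(v) ∖ S| - 1, 0)). We prove:
--  * Closure: cl S is the least closed superset of S, where S is closed if the color
--    change rule adds nothing to it.
--  * Soundness: if S ⊆ cl F with |F| ≤ r, then every successor state is covered in the
--    same way by a set of size at most the successor budget (choose v and all uncolored
--    neighbours of v but one; v then forces the last one).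
--  * Completeness: for a zero forcing set F, the full set ⊤ is reachable from ∅ with
--    total budget at most |F|, each step being paid for by newly colored vertices of F.
--  * Loop invariants: before round R the list records every state reachable with budget
--    below R (with at most that budget), and every recorded state is sound and not ⊤.
-- Hence the first value returned is achieved by a zero forcing set and is at most the
-- size of every zero forcing set, i.e. it equals Z(G).

open import Defs
open import Data.Nat using (ℕ; zero; suc; _+_; _∸_; _≤_; _<_; z≤n; s≤s; _≤ᵇ_; _<?_)
open import Data.Nat.Properties
  using (+-assoc; +-comm; +-identityʳ; +-mono-≤; +-monoʳ-≤; +-monoˡ-≤; +-suc; <⇒≱;
         m+n≡0⇒m≡0; m+n≡0⇒n≡0; m<m+n; m∸n≡0⇒m≤n; m∸n≤m; m≤m+n; m≤n+o⇒m∸n≤o; n<1⇒n≡0;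
         n≤1+n; suc[m]≤n⇒m≤pred[n]; ≡ᵇ⇒≡; ≡⇒≡ᵇ; ≤-antisym; ≤-pred; ≤-refl; ≤-reflexive;
         ≤-trans; ≤ᵇ⇒≤; ≤⇒≤ᵇ; ≮⇒≥; module ≤-Reasoning)
open import Data.Bool using (Bool; true; false; T; not; _∧_; if_then_else_)
  renaming (_≟_ to _≟ᵇ_)
open import Data.Bool.Properties using (T-≡; T-∨; T-∧)
open import Data.Bool.ListAction using (any)
open import Data.Fin using (Fin; zero; suc) renaming (_≟_ to _≟ᶠ_)
open import Data.Fin.Properties using (any?)
open import Data.Fin.Subset
  using (Subset; ⊤; ⊥; _∪_; _∩_; _─_; _-_; ∣_∣; ⁅_⁆; _∈_; _∉_; _⊆_; _⊈_)
open import Data.Fin.Subset.Properties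
  using (_∈?_; _⊆?_; ⊆-refl; ⊆-trans; ⊆-antisym; ∈⊤; ∉⊥; ⊥⊆; ∣⊥∣≡0; ∣⁅x⁆∣≡1; ∣p∣≤n;
         ∣p∣≡n⇒p≡⊤; ∣p∩q∣≤∣p∣; x∈⁅x⁆; x∈⁅y⁆⇒x≡y; x∈p∪q⁻; x∈p∩q⁺; x∈p∩q⁻;
         x∈p∧x∉q⇒x∈p─q; x∈p∧x≢y⇒x∈p-y; x∈p⇒∣p-x∣<∣p∣; p⊆p∪q; q⊆p∪q;
         p⊆q⇒∣p∣≤∣q∣; p⊂q⇒∣p∣<∣q∣; nonempty?; Empty-unique; drop-there)
open import Data.Vec using ([]; _∷_; tabulate; lookup; here; there)
open import Data.Vec.Properties using ([]=⇒lookup; lookup⇒[]=; lookup∘tabulate; ≡-dec)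
open import Data.List using (List; []; _∷_; _++_; [_]; allFin)
open import Data.List.Relation.Unary.Any using (here; there; satisfied)
open import Data.List.Relation.Unary.Any.Properties using (any⁺; any⁻)
open import Data.List.Membership.Propositional using (lose; find) renaming (_∈_ to _∈ᴸ_)
open import Data.List.Membership.Propositional.Properties using (∈-allFin; ∈-++⁺ʳ; ∈-++⁻)
open import Data.List.Relation.Binary.Subset.Propositional using () renaming (_⊆_ to _⊆ᴸ_)
open import Data.List.Relation.Binary.Subset.Propositional.Properties using (xs⊆xs++ys)
open import Data.Maybe using (just)
open import Data.Product using (Σ; ∃; _×_; _,_; proj₁; proj₂)
open import Data.Sum using (_⊎_; inj₁; inj₂)
open import Data.Empty using (⊥-elim)
open import Function using (_∘_; Equivalence)
open import Relation.Nullary using (¬_; yes; no; contradiction; ¬?)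
open import Relation.Nullary.Decidable using (_×-dec_; toWitness; toWitnessFalse)
open import Relation.Binary.PropositionalEquality
  using (_≡_; _≢_; refl; sym; trans; cong; cong₂; subst; module ≡-Reasoning)

∈⇒T : ∀ {n} {x : Fin n} {p : Subset n} → x ∈ p → T (lookup p x)
∈⇒T x∈p = Equivalence.from T-≡ ([]=⇒lookup x∈p)

T⇒∈ : ∀ {n} {x : Fin n} {p : Subset n} → T (lookup p x) → x ∈ p
T⇒∈ {x = x} {p} t = lookup⇒[]= x p (Equivalence.to T-≡ t)

∈-tabulate⁻ : ∀ {n} {x : Fin n} (f : Fin n → Bool) → x ∈ tabulate f → T (f x)
∈-tabulate⁻ {x = x} f x∈ = subst T (lookup∘tabulate f x) (∈⇒T x∈)

∈-tabulate⁺ : ∀ {n} {x : Fin n} (f : Fin n → Bool) → T (f x) → x ∈ tabulate f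
∈-tabulate⁺ {x = x} f t = T⇒∈ (subst T (sym (lookup∘tabulate f x)) t)

x∈p─q⁻ : ∀ {n} {x : Fin n} (p q : Subset n) → x ∈ p ─ q → x ∈ p × x ∉ q
x∈p─q⁻ (true ∷ p) (false ∷ q) here = here , λ ()
x∈p─q⁻ {x = zero} (false ∷ p) (false ∷ q) ()
x∈p─q⁻ {x = zero} (false ∷ p) (true ∷ q) ()
x∈p─q⁻ (_ ∷ p) (_ ∷ q) (there x∈) with x∈p─q⁻ p q x∈
... | x∈p , x∉q = there x∈p , x∉q ∘ drop-there

─-antitone : ∀ {n} {Y Z : Subset n} (p : Subset n) → Y ⊆ Z → p ─ Z ⊆ p ─ Y
─-antitone {Y = Y} {Z} p Y⊆Z x∈ with x∈p─q⁻ p Z x∈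
... | x∈p , x∉Z = x∈p∧x∉q⇒x∈p─q x∈p (x∉Z ∘ Y⊆Z)

⊈⇒∃ : ∀ {n} {p q : Subset n} → p ⊈ q → ∃ λ x → x ∈ p × x ∉ q
⊈⇒∃ {p = p} {q} p⊈q with any? (λ x → x ∈? p ×-dec ¬? (x ∈? q))
... | yes witness = witness
... | no none = ⊥-elim (p⊈q included)
  where
    included : p ⊆ q
    included {x} x∈p with x ∈? q
    ... | yes x∈q = x∈q
    ... | no x∉q = contradiction (x , x∈p , x∉q) none

≢⊤⇒∉ : ∀ {n} {p : Subset n} → p ≢ ⊤ → ∃ λ x → x ∉ p
≢⊤⇒∉ p≢⊤ with ⊈⇒∃ (λ ⊤⊆p → p≢⊤ (⊆-antisym (λ _ → ∈⊤) ⊤⊆p))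
... | x , _ , x∉p = x , x∉p

∣p∪q∣+∣p∩q∣ : ∀ {n} (p q : Subset n) → ∣ p ∪ q ∣ + ∣ p ∩ q ∣ ≡ ∣ p ∣ + ∣ q ∣
∣p∪q∣+∣p∩q∣ [] [] = refl
∣p∪q∣+∣p∩q∣ (true ∷ p) (true ∷ q) =
  cong suc (trans (+-suc _ _) (trans (cong suc (∣p∪q∣+∣p∩q∣ p q)) (sym (+-suc _ _))))
∣p∪q∣+∣p∩q∣ (true ∷ p) (false ∷ q) = cong suc (∣p∪q∣+∣p∩q∣ p q)
∣p∪q∣+∣p∩q∣ (false ∷ p) (true ∷ q) = trans (cong suc (∣p∪q∣+∣p∩q∣ p q)) (sym (+-suc _ _))
∣p∪q∣+∣p∩q∣ (false ∷ p) (false ∷ q) = ∣p∪q∣+∣p∩q∣ p q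

∣p∪q∣≤∣p∣+∣q∣ : ∀ {n} (p q : Subset n) → ∣ p ∪ q ∣ ≤ ∣ p ∣ + ∣ q ∣
∣p∪q∣≤∣p∣+∣q∣ p q = subst (∣ p ∪ q ∣ ≤_) (∣p∪q∣+∣p∩q∣ p q) (m≤m+n _ _)

Disjoint : ∀ {n} → Subset n → Subset n → Set
Disjoint p q = ∀ {x} → x ∈ p → x ∉ q

∣∪∣-disjoint : ∀ {n} (p q : Subset n) → Disjoint p q → ∣ p ∪ q ∣ ≡ ∣ p ∣ + ∣ q ∣
∣∪∣-disjoint {n} p q p∩q=∅ = begin
  ∣ p ∪ q ∣               ≡⟨ sym (+-identityʳ _) ⟩
  ∣ p ∪ q ∣ + 0           ≡⟨ cong (∣ p ∪ q ∣ +_) (sym (trans (cong ∣_∣ p∩q≡⊥) (∣⊥∣≡0 n))) ⟩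
  ∣ p ∪ q ∣ + ∣ p ∩ q ∣   ≡⟨ ∣p∪q∣+∣p∩q∣ p q ⟩
  ∣ p ∣ + ∣ q ∣           ∎
  where
    open ≡-Reasoning
    p∩q≡⊥ : p ∩ q ≡ ⊥
    p∩q≡⊥ = Empty-unique λ { (x , x∈) → let (x∈p , x∈q) = x∈p∩q⁻ p q x∈ in p∩q=∅ x∈p x∈q }

≤1⇒unique : ∀ {n} {p : Subset n} {x y : Fin n} → ∣ p ∣ ≤ 1 → x ∈ p → y ∈ p → x ≡ y
≤1⇒unique {p = p} {x} {y} ∣p∣≤1 x∈p y∈p with x ≟ᶠ y
... | yes x≡y = x≡y
... | no x≢y = contradiction (≤-trans two≤∣p∣ ∣p∣≤1) (λ { (s≤s ()) })
  where
    pair⊆p : ⁅ x ⁆ ∪ ⁅ y ⁆ ⊆ p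
    pair⊆p z∈ with x∈p∪q⁻ ⁅ x ⁆ ⁅ y ⁆ z∈
    ... | inj₁ z∈x rewrite x∈⁅y⁆⇒x≡y x z∈x = x∈p
    ... | inj₂ z∈y rewrite x∈⁅y⁆⇒x≡y y z∈y = y∈p
    disjoint : Disjoint ⁅ x ⁆ ⁅ y ⁆
    disjoint z∈x z∈y = x≢y (trans (sym (x∈⁅y⁆⇒x≡y x z∈x)) (x∈⁅y⁆⇒x≡y y z∈y))
    two≤∣p∣ : 2 ≤ ∣ p ∣
    two≤∣p∣ = subst (_≤ ∣ p ∣)
      (trans (∣∪∣-disjoint ⁅ x ⁆ ⁅ y ⁆ disjoint) (cong₂ _+_ (∣⁅x⁆∣≡1 x) (∣⁅x⁆∣≡1 y)))
      (p⊆q⇒∣p∣≤∣q∣ pair⊆p)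

∈⇒1≤∣∣ : ∀ {n} {p : Subset n} {x : Fin n} → x ∈ p → 1 ≤ ∣ p ∣
∈⇒1≤∣∣ {p = p} {x} x∈p =
  subst (_≤ ∣ p ∣) (∣⁅x⁆∣≡1 x) (p⊆q⇒∣p∣≤∣q∣ λ y∈ → subst (_∈ p) (sym (x∈⁅y⁆⇒x≡y x y∈)) x∈p)

unique⇒∣∣≡1 : ∀ {n} {p : Subset n} {x : Fin n} → x ∈ p → (∀ {y} → y ∈ p → y ≡ x) → ∣ p ∣ ≡ 1
unique⇒∣∣≡1 {p = p} {x} x∈p all≡x = ≤-antisym
  (subst (∣ p ∣ ≤_) (∣⁅x⁆∣≡1 x) (p⊆q⇒∣p∣≤∣q∣ λ y∈ → subst (_∈ ⁅ x ⁆) (sym (all≡x y∈)) (x∈⁅x⁆ x)))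
  (∈⇒1≤∣∣ x∈p)

allButOne : ∀ {n} (p : Subset n) → Σ (Subset n) λ q → ∣ q ∣ ≤ ∣ p ∣ ∸ 1 ×
  (∀ {x y} → x ∈ p → x ∉ q → y ∈ p → y ∉ q → x ≡ y)
allButOne {n} p with nonempty? p
... | yes (u , u∈p) = p - u , suc[m]≤n⇒m≤pred[n] (x∈p⇒∣p-x∣<∣p∣ u∈p) , λ x∈ x∉ y∈ y∉ →
  trans (outside x∈ x∉) (sym (outside y∈ y∉))
  where
    outside : ∀ {x} → x ∈ p → x ∉ p - u → x ≡ u
    outside {x} x∈ x∉ with x ≟ᶠ u
    ... | yes x≡u = x≡u
    ... | no x≢u = contradiction (x∈p∧x≢y⇒x∈p-y x∈ x≢u) x∉
... | no p=∅ = ⊥ , subst (_≤ ∣ p ∣ ∸ 1) (sym (∣⊥∣≡0 n)) z≤n , λ x∈ _ _ _ → contradiction (_ , x∈) p=∅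

-- Hoare-style rule for the early-exit loop forEach whose state is a growing list:
-- Inv is an invariant of the state and Ret a property of any value returned early.
module ForEachRule {X : Set} (Inv : List X → Set) (Ret : ℕ → Set) where

  Post : (List X → Set) → List X → List X ⊎ ℕ → Set
  Post Q C (inj₁ C') = Inv C' × C ⊆ᴸ C' × Q C'
  Post Q C (inj₂ r)  = Ret r

  forEach-rule : ∀ {A : Set} (Q : A → List X → Set) →
    (∀ {a C C'} → Q a C → C ⊆ᴸ C' → Q a C') →
    (xs : List A) (f : A → List X → List X ⊎ ℕ) →
    (∀ {a C} → a ∈ᴸ xs → Inv C → Post (Q a) C (f a C)) →
    ∀ {C} → Inv C → Post (λ C' → ∀ {a} → a ∈ᴸ xs → Q a C') C (forEach xs f C)
  forEach-rule Q mono [] f body inv = inv , (λ c∈ → c∈) , λ ()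
  forEach-rule Q mono (a ∷ xs) f body {C} inv with f a C | body (here refl) inv
  ... | inj₂ r | ret = ret
  ... | inj₁ C₁ | (inv₁ , C⊆C₁ , Qa)
    with forEach xs f C₁ | forEach-rule Q mono xs f (λ a∈ → body (there a∈)) inv₁
  ...   | inj₂ r | ret = ret
  ...   | inj₁ C₂ | (inv₂ , C₁⊆C₂ , Qxs) =
    inv₂ , (λ c∈ → C₁⊆C₂ (C⊆C₁ c∈)) , λ { (here refl) → mono Qa C₁⊆C₂ ; (there a∈) → Qxs a∈ }

=ˢ⇒≡ : ∀ {n} {S S' : Subset n} → T (S =ˢ S') → S ≡ S'
=ˢ⇒≡ {S = S} {S'} = toWitness {a? = ≡-dec _≟ᵇ_ S S'}

=ˢ≡false⇒≢ : ∀ {n} {S S' : Subset n} → (S =ˢ S') ≡ false → S ≢ S'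
=ˢ≡false⇒≢ {S = S} {S'} eq = toWitnessFalse {a? = ≡-dec _≟ᵇ_ S S'} (subst (T ∘ not) (sym eq) _)

module _ {n : ℕ} (G : Graph n) where
  open Graph G using (adj; irrefl)

  Nb : Fin n → Subset n
  Nb = N G

  Nb[_] : Fin n → Subset n
  Nb[ v ] = N[_] G v

  v∉Nb : ∀ v → v ∉ Nb v
  v∉Nb v v∈ = subst T (irrefl v) (∈-tabulate⁻ (adj v) v∈)

  ∈-Nb[]⁻ : ∀ {u v} → u ∈ Nb[ v ] → u ∈ Nb v ⊎ u ≡ v
  ∈-Nb[]⁻ {u} {v} u∈ with x∈p∪q⁻ (Nb v) ⁅ v ⁆ u∈
  ... | inj₁ u∈Nv = inj₁ u∈Nv
  ... | inj₂ u∈v = inj₂ (x∈⁅y⁆⇒x≡y v u∈v)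

  v∈Nb[v] : ∀ v → v ∈ Nb[ v ]
  v∈Nb[v] v = q⊆p∪q (Nb v) ⁅ v ⁆ (x∈⁅x⁆ v)

  Forces : Subset n → Fin n → Fin n → Set
  Forces S v u = v ∈ S × ∣ Nb v ─ S ∣ ≡ 1 × u ∈ Nb v ─ S

  ∈-forceStep⁻ : ∀ {S u} → u ∈ forceStep G S → u ∈ S ⊎ ∃ λ v → Forces S v u
  ∈-forceStep⁻ {S} {u} u∈ with Equivalence.to T-∨ (∈-tabulate⁻ _ u∈)
  ... | inj₁ u∈S = inj₁ (T⇒∈ u∈S)
  ... | inj₂ someForcer with satisfied (any⁻ _ (allFin n) someForcer)
  ... | v , forcing with Equivalence.to T-∧ forcing
  ... | v∈S , rest with Equivalence.to T-∧ rest
  ... | one , u∈Nv─S = inj₂ (v , T⇒∈ v∈S , ≡ᵇ⇒≡ _ 1 one , T⇒∈ u∈Nv─S)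

  ∈-forceStep⁺ : ∀ {S u v} → Forces S v u → u ∈ forceStep G S
  ∈-forceStep⁺ {S} {u} {v} (v∈S , one , u∈Nv─S) = ∈-tabulate⁺ _ (Equivalence.from T-∨ (inj₂
    (any⁺ _ (lose (∈-allFin v) (Equivalence.from T-∧
      (∈⇒T v∈S , Equivalence.from T-∧ (≡⇒≡ᵇ _ 1 one , ∈⇒T u∈Nv─S)))))))

  ⊆-forceStep : ∀ {S} → S ⊆ forceStep G S
  ⊆-forceStep u∈S = ∈-tabulate⁺ _ (Equivalence.from T-∨ (inj₁ (∈⇒T u∈S)))

  Closed : Subset n → Set
  Closed S = forceStep G S ⊆ S

  closed-saturate : ∀ {Z v} → Closed Z → v ∈ Z →
    (∀ {x y} → x ∈ Nb v ─ Z → y ∈ Nb v ─ Z → x ≡ y) → Nb v ⊆ Z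
  closed-saturate {Z} {v} closed v∈Z atMostOne {u} u∈Nv with u ∈? Z
  ... | yes u∈Z = u∈Z
  ... | no u∉Z = closed (∈-forceStep⁺ (v∈Z , unique⇒∣∣≡1 u∈ (λ y∈ → atMostOne y∈ u∈) , u∈))
    where
      u∈ : u ∈ Nb v ─ Z
      u∈ = x∈p∧x∉q⇒x∈p─q u∈Nv u∉Z

  forceStep-least : ∀ {Y Z} → Y ⊆ Z → Closed Z → forceStep G Y ⊆ Z
  forceStep-least {Y} {Z} Y⊆Z closed u∈ with ∈-forceStep⁻ u∈
  ... | inj₁ u∈Y = Y⊆Z u∈Y
  ... | inj₂ (v , v∈Y , one , u∈Nv─Y) =
    closed-saturate closed (Y⊆Z v∈Y)
      (λ x∈ y∈ → ≤1⇒unique (≤-reflexive one) (shrink x∈) (shrink y∈))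
      (proj₁ (x∈p─q⁻ (Nb v) Y u∈Nv─Y))
    where
      shrink : Nb v ─ Z ⊆ Nb v ─ Y
      shrink = ─-antitone (Nb v) Y⊆Z

  closed-fixed : ∀ {S} → Closed S → forceStep G S ≡ S
  closed-fixed closed = ⊆-antisym closed ⊆-forceStep

  unclosed-grows : ∀ {S} → ¬ Closed S → ∣ S ∣ < ∣ forceStep G S ∣
  unclosed-grows notClosed = p⊂q⇒∣p∣<∣q∣ (⊆-forceStep , ⊈⇒∃ notClosed)

  saturation : ∀ k S → Closed (iter k (forceStep G) S) ⊎ k ≤ ∣ iter k (forceStep G) S ∣
  saturation zero S = inj₂ z≤n
  saturation (suc k) S with forceStep G (iter k (forceStep G) S) ⊆? iter k (forceStep G) S
  ... | yes closed = inj₁ (subst Closed (sym (closed-fixed closed)) closed)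
  ... | no notClosed with saturation k S
  ...   | inj₁ closed = ⊥-elim (notClosed closed)
  ...   | inj₂ k≤ = inj₂ (≤-trans (s≤s k≤) (unclosed-grows notClosed))

  -- cl S is the least closed superset of S: it is closed (n rounds suffice, since each
  -- round before stabilisation colors a new vertex), contains S and lies in every closed
  -- superset of S.
  cl-closed : ∀ S → Closed (cl G S)
  cl-closed S with saturation n S
  ... | inj₁ closed = closed
  ... | inj₂ n≤ = subst Closed (sym (∣p∣≡n⇒p≡⊤ (≤-antisym (∣p∣≤n (cl G S)) n≤))) (λ _ → ∈⊤)

  cl-extensive : ∀ {S} → S ⊆ cl G S
  cl-extensive = go n
    where
      go : ∀ {S} k → S ⊆ iter k (forceStep G) S
      go zero x∈ = x∈
      go (suc k) x∈ = ⊆-forceStep (go k x∈)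

  cl-least : ∀ {Y Z} → Y ⊆ Z → Closed Z → cl G Y ⊆ Z
  cl-least Y⊆Z closed = go n
    where
      go : ∀ k → iter k (forceStep G) _ ⊆ _
      go zero = Y⊆Z
      go (suc k) = forceStep-least (go k) closed

  cl-mono : ∀ {A B} → A ⊆ B → cl G A ⊆ cl G B
  cl-mono {B = B} A⊆B = cl-least (⊆-trans A⊆B cl-extensive) (cl-closed B)

  closed-⊥ : Closed ⊥
  closed-⊥ u∈ with ∈-forceStep⁻ u∈
  ... | inj₁ u∈⊥ = u∈⊥
  ... | inj₂ (v , v∈⊥ , _) = ⊥-elim (∉⊥ v∈⊥)

  ∪Nb[]⊆ : ∀ {S Z v} → S ⊆ Z → v ∈ Z → Nb v ⊆ Z → S ∪ Nb[ v ] ⊆ Z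
  ∪Nb[]⊆ {S} {Z} {v} S⊆Z v∈Z Nv⊆Z x∈ with x∈p∪q⁻ S Nb[ v ] x∈
  ... | inj₁ x∈S = S⊆Z x∈S
  ... | inj₂ x∈N[v] with ∈-Nb[]⁻ x∈N[v]
  ...   | inj₁ x∈Nv = Nv⊆Z x∈Nv
  ...   | inj₂ refl = v∈Z

  -- Its price is the number of vertices of N[v] that must be chosen to achieve this:
  -- v itself if uncolored, and all uncolored neighbours but one (which v then forces).
  expand : Subset n → Fin n → Subset n
  expand S v = cl G (S ∪ Nb[ v ])

  cost : Subset n → Fin n → ℕ
  cost S v = ∣ ⁅ v ⁆ ─ S ∣ + (∣ Nb v ─ S ∣ ∸ 1)

  charge : ℕ → Subset n → Fin n → ℕ
  charge r S v = r + ∣ ⁅ v ⁆ ─ S ∣ + (∣ Nb v ─ S ∣ ∸ 1)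

  charge≡ : ∀ r S v → charge r S v ≡ r + cost S v
  charge≡ r S v = +-assoc r _ _

  free-expansion : ∀ {P v} → Closed P → cost P v ≡ 0 → expand P v ≡ P
  free-expansion {P} {v} closed free =
    ⊆-antisym (cl-least (∪Nb[]⊆ ⊆-refl v∈P Nv⊆P) closed) (⊆-trans (p⊆p∪q Nb[ v ]) cl-extensive)
    where
      v∈P : v ∈ P
      v∈P with v ∈? P
      ... | yes v∈P = v∈P
      ... | no v∉P = contradiction
        (subst (1 ≤_) free (≤-trans (∈⇒1≤∣∣ (x∈p∧x∉q⇒x∈p─q (x∈⁅x⁆ v) v∉P)) (m≤m+n _ _))) λ ()
      Nv⊆P : Nb v ⊆ P
      Nv⊆P = closed-saturate closed v∈P (≤1⇒unique (m∸n≡0⇒m≤n (m+n≡0⇒n≡0 _ free)))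

  Coverable : Subset n → ℕ → Set
  Coverable S r = Σ (Subset n) λ F → ∣ F ∣ ≤ r × S ⊆ cl G F

  -- Soundness of a transition: add v (if uncolored) and all uncolored neighbours of v
  -- but one to the initial set; v then forces the remaining neighbour.
  coverable-expand : ∀ {S r} v → Coverable S r → Coverable (expand S v) (charge r S v)
  coverable-expand {S} {r} v (F , ∣F∣≤r , S⊆clF) with allButOne (Nb v ─ S)
  ... | D , ∣D∣≤ , oneOutsideD =
    F' , ∣F'∣≤charge , cl-least (∪Nb[]⊆ S⊆Z v∈Z Nv⊆Z) (cl-closed F')
    where
      F' : Subset n
      F' = F ∪ (⁅ v ⁆ ─ S) ∪ D
      Z : Subset n
      Z = cl G F'
      ∣F'∣≤charge : ∣ F' ∣ ≤ charge r S v
      ∣F'∣≤charge = begin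
        ∣ F' ∣                             ≤⟨ ∣p∪q∣≤∣p∣+∣q∣ F ((⁅ v ⁆ ─ S) ∪ D) ⟩
        ∣ F ∣ + ∣ (⁅ v ⁆ ─ S) ∪ D ∣        ≤⟨ +-mono-≤ ∣F∣≤r (∣p∪q∣≤∣p∣+∣q∣ (⁅ v ⁆ ─ S) D) ⟩
        r + (∣ ⁅ v ⁆ ─ S ∣ + ∣ D ∣)        ≤⟨ +-monoʳ-≤ r (+-monoʳ-≤ ∣ ⁅ v ⁆ ─ S ∣ ∣D∣≤) ⟩
        r + cost S v                       ≡⟨ sym (charge≡ r S v) ⟩
        charge r S v                       ∎
        where open ≤-Reasoning
      S⊆Z : S ⊆ Z
      S⊆Z = cl-mono (p⊆p∪q _) ∘ S⊆clF
      v∈Z : v ∈ Z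
      v∈Z with v ∈? S
      ... | yes v∈S = S⊆Z v∈S
      ... | no v∉S = cl-extensive (q⊆p∪q F _ (p⊆p∪q D (x∈p∧x∉q⇒x∈p─q (x∈⁅x⁆ v) v∉S)))
      outsideD : ∀ {x} → x ∈ Nb v ─ Z → x ∉ D
      outsideD x∈ x∈D = proj₂ (x∈p─q⁻ (Nb v) Z x∈) (cl-extensive (q⊆p∪q F _ (q⊆p∪q _ D x∈D)))
      Nv⊆Z : Nb v ⊆ Z
      Nv⊆Z = closed-saturate (cl-closed F') v∈Z λ x∈ y∈ →
        oneOutsideD (─-antitone (Nb v) S⊆Z x∈) (outsideD x∈) (─-antitone (Nb v) S⊆Z y∈) (outsideD y∈)

  data Reachable : Subset n → ℕ → Set where
    start : Reachable ⊥ 0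
    step  : ∀ {S r} v → Reachable S r → Reachable (expand S v) (charge r S v)

  reachable-closed : ∀ {S r} → Reachable S r → Closed S
  reachable-closed start = closed-⊥
  reachable-closed (step {S} v _) = cl-closed (S ∪ Nb[ v ])

  reachable-0 : ∀ {S k} → Reachable S k → k ≡ 0 → S ≡ ⊥
  reachable-0 start _ = refl
  reachable-0 (step {S} {r} v d) charge≡0 =
    trans (cong (λ P → expand P v) S≡⊥)
      (free-expansion closed-⊥ (subst (λ P → cost P v ≡ 0) S≡⊥ (m+n≡0⇒n≡0 r r+cost≡0)))
    where
      r+cost≡0 : r + cost S v ≡ 0
      r+cost≡0 = trans (sym (charge≡ r S v)) charge≡0
      S≡⊥ : S ≡ ⊥
      S≡⊥ = reachable-0 d (m+n≡0⇒m≡0 r r+cost≡0)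

  -- Completeness: a zero forcing set F is simulated by transitions of total charge ≤ |F|.
  -- The charge of each transition is paid by distinct vertices of F that become colored.
  module _ {F : Subset n} (F-forces : ⊤ ⊆ cl G F) where

    Affordable : Subset n → Fin n → Set
    Affordable S x = (x ∉ S → x ∈ F) × (∣ Nb x ─ S ∣ ∸ 1 ≤ ∣ (Nb x ─ S) ∩ F ∣)

    affordable-if-covered : ∀ {S j} → ⊤ ⊆ S ∪ F → j ∉ S → Affordable S j
    affordable-if-covered {S} {j} covered j∉S =
      (λ _ → inF j∉S) , ≤-trans (m∸n≤m _ 1) (p⊆q⇒∣p∣≤∣q∣ N─S⊆F)
      where
        inF : ∀ {y} → y ∉ S → y ∈ F
        inF {y} y∉S with x∈p∪q⁻ S F (covered ∈⊤)
        ... | inj₁ y∈S = contradiction y∈S y∉S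
        ... | inj₂ y∈F = y∈F
        N─S⊆F : Nb j ─ S ⊆ (Nb j ─ S) ∩ F
        N─S⊆F y∈ = x∈p∩q⁺ (y∈ , inF (proj₂ (x∈p─q⁻ (Nb j) S y∈)))

    -- If x forces u in S ∪ F, then x is an affordable transition from S: its only
    -- uncolored neighbour outside F is u.
    affordable-if-forcing : ∀ {S x u} → Forces (S ∪ F) x u → Affordable S x
    affordable-if-forcing {S} {x} {u} (x∈S∪F , one , u∈Nx─S∪F) =
      x∈F , m≤n+o⇒m∸n≤o _ 1 bound
      where
        x∈F : x ∉ S → x ∈ F
        x∈F x∉S with x∈p∪q⁻ S F x∈S∪F
        ... | inj₁ x∈S = contradiction x∈S x∉S
        ... | inj₂ x∈F = x∈F
        split : Nb x ─ S ⊆ ⁅ u ⁆ ∪ ((Nb x ─ S) ∩ F)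
        split {y} y∈ with y ∈? F
        ... | yes y∈F = q⊆p∪q ⁅ u ⁆ _ (x∈p∩q⁺ (y∈ , y∈F))
        ... | no y∉F = p⊆p∪q _ (subst (_∈ ⁅ u ⁆) (sym y≡u) (x∈⁅x⁆ u))
          where
            y∉S∪F : y ∉ S ∪ F
            y∉S∪F y∈S∪F with x∈p∪q⁻ S F y∈S∪F
            ... | inj₁ y∈S = proj₂ (x∈p─q⁻ (Nb x) S y∈) y∈S
            ... | inj₂ y∈F = y∉F y∈F
            y≡u : y ≡ u
            y≡u = ≤1⇒unique (≤-reflexive one)
              (x∈p∧x∉q⇒x∈p─q (proj₁ (x∈p─q⁻ (Nb x) S y∈)) y∉S∪F) u∈Nx─S∪F
        bound : ∣ Nb x ─ S ∣ ≤ 1 + ∣ (Nb x ─ S) ∩ F ∣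
        bound = ≤-trans (p⊆q⇒∣p∣≤∣q∣ split)
          (subst (λ k → ∣ ⁅ u ⁆ ∪ B ∣ ≤ k + ∣ B ∣) (∣⁅x⁆∣≡1 u) (∣p∪q∣≤∣p∣+∣q∣ ⁅ u ⁆ B))
          where B = (Nb x ─ S) ∩ F

    -- Every incomplete state has an affordable transition that colors a new vertex:
    -- either S ∪ F is everything, or S ∪ F is not closed (as cl F = ⊤) and some vertex
    -- forces a vertex outside S ∪ F.
    affordable-exists : ∀ {S j} → j ∉ S →
      ∃ λ x → Affordable S x × ∃ λ u → u ∉ S × u ∈ Nb[ x ]
    affordable-exists {S} {j} j∉S with ⊤ ⊆? S ∪ F
    ... | yes covered = j , affordable-if-covered covered j∉S , j , j∉S , v∈Nb[v] j
    ... | no uncovered with ⊈⇒∃ notClosed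
      where
        notClosed : ¬ Closed (S ∪ F)
        notClosed closed = uncovered (cl-least (q⊆p∪q S F) closed ∘ F-forces)
    ... | u , u∈forced , u∉S∪F with ∈-forceStep⁻ u∈forced
    ...   | inj₁ u∈S∪F = contradiction u∈S∪F u∉S∪F
    ...   | inj₂ (x , forcing@(_ , _ , u∈Nx─S∪F)) =
      x , affordable-if-forcing forcing , u , u∉S∪F ∘ p⊆p∪q F ,
      p⊆p∪q ⁅ x ⁆ (proj₁ (x∈p─q⁻ (Nb x) _ u∈Nx─S∪F))

    -- An affordable transition is paid for: the vertex x (if new) and the uncolored
    -- neighbours in F are disjoint from F ∩ S and all lie in F ∩ expand S x.
    affordable-gain : ∀ {S x} → Affordable S x → cost S x + ∣ F ∩ S ∣ ≤ ∣ F ∩ expand S x ∣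
    affordable-gain {S} {x} (x∈F , bound) = begin
      ∣ A ∣ + (∣ Nb x ─ S ∣ ∸ 1) + ∣ C ∣  ≤⟨ +-monoˡ-≤ ∣ C ∣ (+-monoʳ-≤ ∣ A ∣ bound) ⟩
      ∣ A ∣ + ∣ B ∣ + ∣ C ∣              ≡⟨ +-assoc (∣ A ∣) (∣ B ∣) (∣ C ∣) ⟩
      ∣ A ∣ + (∣ B ∣ + ∣ C ∣)            ≡⟨ cong (∣ A ∣ +_) (sym (∣∪∣-disjoint B C B∩C=∅)) ⟩
      ∣ A ∣ + ∣ B ∪ C ∣                  ≡⟨ sym (∣∪∣-disjoint A (B ∪ C) A∩BC=∅) ⟩
      ∣ A ∪ B ∪ C ∣                      ≤⟨ p⊆q⇒∣p∣≤∣q∣ ABC⊆ ⟩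
      ∣ F ∩ expand S x ∣                 ∎
      where
        open ≤-Reasoning
        A B C : Subset n
        A = ⁅ x ⁆ ─ S
        B = (Nb x ─ S) ∩ F
        C = F ∩ S
        S' = expand S x
        ∉S : ∀ {y} → y ∈ Nb x ─ S → y ∉ S
        ∉S y∈ = proj₂ (x∈p─q⁻ (Nb x) S y∈)
        B∩C=∅ : Disjoint B C
        B∩C=∅ y∈B y∈C = ∉S (proj₁ (x∈p∩q⁻ _ F y∈B)) (proj₂ (x∈p∩q⁻ F S y∈C))
        A∩BC=∅ : Disjoint A (B ∪ C)
        A∩BC=∅ y∈A y∈BC with x∈p─q⁻ ⁅ x ⁆ S y∈A | x∈p∪q⁻ B C y∈BC
        ... | y∈x , _ | inj₁ y∈B rewrite x∈⁅y⁆⇒x≡y x y∈x =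
          v∉Nb x (proj₁ (x∈p─q⁻ (Nb x) S (proj₁ (x∈p∩q⁻ _ F y∈B))))
        ... | _ , y∉S | inj₂ y∈C = y∉S (proj₂ (x∈p∩q⁻ F S y∈C))
        ∪⊆S' : S ∪ Nb[ x ] ⊆ S'
        ∪⊆S' = cl-extensive
        ABC⊆ : A ∪ B ∪ C ⊆ F ∩ S'
        ABC⊆ y∈ with x∈p∪q⁻ A (B ∪ C) y∈
        ... | inj₁ y∈A with x∈p─q⁻ ⁅ x ⁆ S y∈A
        ...   | y∈x , y∉S rewrite x∈⁅y⁆⇒x≡y x y∈x = x∈p∩q⁺ (x∈F y∉S , ∪⊆S' (q⊆p∪q S _ (v∈Nb[v] x)))
        ABC⊆ y∈ | inj₂ y∈BC with x∈p∪q⁻ B C y∈BC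
        ... | inj₁ y∈B = let (y∈N─S , y∈F) = x∈p∩q⁻ _ F y∈B in
          x∈p∩q⁺ (y∈F , ∪⊆S' (q⊆p∪q S _ (p⊆p∪q ⁅ x ⁆ (proj₁ (x∈p─q⁻ (Nb x) S y∈N─S)))))
        ... | inj₂ y∈C = let (y∈F , y∈S) = x∈p∩q⁻ F S y∈C in
          x∈p∩q⁺ (y∈F , ∪⊆S' (p⊆p∪q _ y∈S))

    -- Repeating affordable transitions reaches ⊤ within the budget |F|
    -- (the fuel bounds the number of vertices still to be colored).
    reach-⊤ : ∀ fuel {S k} → n ≤ fuel + ∣ S ∣ → Reachable S k → k ≤ ∣ F ∩ S ∣ →
      ∃ λ k' → Reachable ⊤ k' × k' ≤ ∣ F ∣
    reach-⊤ fuel {S} {k} n≤ d k≤ with ≡-dec _≟ᵇ_ S ⊤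
    ... | yes refl = k , d , ≤-trans k≤ (∣p∩q∣≤∣p∣ F ⊤)
    ... | no S≢⊤ with fuel | ≢⊤⇒∉ S≢⊤
    ...   | zero | _ = contradiction (∣p∣≡n⇒p≡⊤ (≤-antisym (∣p∣≤n S) n≤)) S≢⊤
    ...   | suc fuel' | j , j∉S with affordable-exists j∉S
    ...     | x , affordable , u , u∉S , u∈N[x] =
      reach-⊤ fuel' n≤fuel'+∣S'∣ (step x d) k'≤
      where
        S⊆S' : S ⊆ expand S x
        S⊆S' = cl-extensive ∘ p⊆p∪q Nb[ x ]
        grows : ∣ S ∣ < ∣ expand S x ∣
        grows = p⊂q⇒∣p∣<∣q∣ (S⊆S' , u , cl-extensive (q⊆p∪q S _ u∈N[x]) , u∉S)
        n≤fuel'+∣S'∣ : n ≤ fuel' + ∣ expand S x ∣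
        n≤fuel'+∣S'∣ =
          ≤-trans n≤ (≤-trans (≤-reflexive (sym (+-suc fuel' ∣ S ∣))) (+-monoʳ-≤ fuel' grows))
        k'≤ : charge k S x ≤ ∣ F ∩ expand S x ∣
        k'≤ = begin
          charge k S x             ≡⟨ charge≡ k S x ⟩
          k + cost S x             ≤⟨ +-monoˡ-≤ (cost S x) k≤ ⟩
          ∣ F ∩ S ∣ + cost S x     ≡⟨ +-comm ∣ F ∩ S ∣ (cost S x) ⟩
          cost S x + ∣ F ∩ S ∣     ≤⟨ affordable-gain affordable ⟩
          ∣ F ∩ expand S x ∣       ∎
          where open ≤-Reasoning

    zfs-reachable : ∃ λ k → Reachable ⊤ k × k ≤ ∣ F ∣
    zfs-reachable = reach-⊤ n (m≤m+n n _) start z≤n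

  Sound : ℕ → Pairs G → Set
  Sound R C = ∀ {S r} → (S , r) ∈ᴸ C → Coverable S r × r ≤ R × S ≢ ⊤

  Complete : ℕ → Pairs G → Set
  Complete R C = ∀ {S k} → Reachable S k → k < R → ∃ λ c → (S , c) ∈ᴸ C × c ≤ k

  Returned : ℕ → ℕ → Set
  Returned R r = Coverable ⊤ r × r ≤ R

  Explored : ℕ → Subset n → ℕ → Fin n → Pairs G → Set
  Explored R P r v C = charge r P v ≤ R → ∃ λ c → (expand P v , c) ∈ᴸ C

  explored-mono : ∀ {R P r v C C'} → Explored R P r v C → C ⊆ᴸ C' → Explored R P r v C'
  explored-mono explored C⊆C' within with explored within
  ... | c , c∈ = c , C⊆C' c∈

  AllExplored : ℕ → Subset n × ℕ → Pairs G → Set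
  AllExplored R (P , r) C = ∀ {v} → v ∈ᴸ allFin n → Explored R P r v C

  module _ (R : ℕ) where
    open ForEachRule (Sound R) (Returned R)

    transition-spec : ∀ {P r} v → Coverable P r → ∀ {C} → Sound R C →
      Post (Explored R P r v) C (wfStep G R (P , r) v C)
    transition-spec {P} {r} v coverable {C} sound =
      by-cases (charge r P v ≤ᵇ R) (any recorded C) (expand P v =ˢ ⊤) refl refl refl
      where
        recorded : Subset n × ℕ → Bool
        recorded (S , c) = (S =ˢ expand P v) ∧ (c ≤ᵇ R)
        by-cases : ∀ fits known full → (charge r P v ≤ᵇ R) ≡ fits → any recorded C ≡ known →
          (expand P v =ˢ ⊤) ≡ full →
          Post (Explored R P r v) C
            (if fits ∧ not known
             then (if full then inj₂ (charge r P v)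
                   else inj₁ (C ++ [ (expand P v , charge r P v) ]))
             else inj₁ C)
        by-cases false known full too-big _ _ = sound , (λ c∈ → c∈) ,
          λ within → contradiction (trans (sym too-big) (Equivalence.to T-≡ (≤⇒≤ᵇ within))) λ ()
        by-cases true true full _ found _ = sound , (λ c∈ → c∈) , λ _ → entry
          where
            entry : ∃ λ c → (expand P v , c) ∈ᴸ C
            entry with find (any⁻ recorded C (Equivalence.from T-≡ found))
            ... | (S , c) , p∈ , rec with Equivalence.to T-∧ rec
            ...   | same , _ = c , subst (λ S' → (S' , c) ∈ᴸ C) (=ˢ⇒≡ same) p∈
        by-cases true false true fits _ full =
          subst (λ S → Coverable S (charge r P v)) (=ˢ⇒≡ (Equivalence.from T-≡ full))
            (coverable-expand v coverable) ,
          ≤ᵇ⇒≤ _ R (Equivalence.from T-≡ fits)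
        by-cases true false false fits _ notFull =
          sound' , xs⊆xs++ys C _ , λ _ → _ , ∈-++⁺ʳ C (here refl)
          where
            sound' : Sound R (C ++ [ (expand P v , charge r P v) ])
            sound' p∈ with ∈-++⁻ C p∈
            ... | inj₁ p∈C = sound p∈C
            ... | inj₂ (here refl) =
              coverable-expand v coverable , ≤ᵇ⇒≤ _ R (Equivalence.from T-≡ fits) , =ˢ≡false⇒≢ notFull

    round-spec : ∀ {C₀} → Sound R C₀ →
      Post (λ C' → ∀ {p} → p ∈ᴸ C₀ → AllExplored R p C') C₀ (wfRound G R C₀)
    round-spec {C₀} sound₀ =
      forEach-rule (AllExplored R) (λ all C⊆C' v∈ → explored-mono (all v∈) C⊆C')
        C₀ (λ p → forEach (allFin n) (wfStep G R p)) pair-spec sound₀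
      where
        pair-spec : ∀ {p C} → p ∈ᴸ C₀ → Sound R C →
          Post (AllExplored R p) C (forEach (allFin n) (wfStep G R p) C)
        pair-spec {P , r} p∈ =
          forEach-rule (Explored R P r) explored-mono (allFin n) (wfStep G R (P , r))
            (λ {v} _ → transition-spec v (proj₁ (sound₀ p∈)))

  charge-mono : ∀ {c r} P v → c ≤ r → charge c P v ≤ charge r P v
  charge-mono P v c≤r = +-monoˡ-≤ _ (+-monoˡ-≤ _ c≤r)

  -- A state reachable with charge exactly R is recorded after round R: either its last
  -- transition was free (and the state is the previous one), or the previous state was
  -- recorded with charge below R and its successors were explored in this round.
  recorded-at-bound : ∀ {R C₀ C'} → 1 ≤ R → Complete R C₀ → Sound R C' →
    (∀ {p} → p ∈ᴸ C₀ → AllExplored R p C') →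
    ∀ {S k} → Reachable S k → k ≡ R → ∃ λ c → (S , c) ∈ᴸ C' × c ≤ k
  recorded-at-bound 1≤R _ _ _ start refl = contradiction 1≤R λ ()
  recorded-at-bound {R} {C' = C'} 1≤R complete₀ sound' explored (step {P} {r} v d) k≡R
    with cost P v in cost≡
  ... | zero =
    let (c , P∈ , c≤r) = recorded-at-bound 1≤R complete₀ sound' explored d (trans (sym charge≡r) k≡R)
    in c , subst (λ S → (S , c) ∈ᴸ C') (sym (free-expansion (reachable-closed d) cost≡)) P∈ ,
       ≤-trans c≤r (≤-reflexive (sym charge≡r))
    where
      charge≡r : charge r P v ≡ r
      charge≡r = trans (charge≡ r P v) (trans (cong (r +_) cost≡) (+-identityʳ r))
  ... | suc _ with complete₀ d r<R
    where
      r<R : r < R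
      r<R = subst (r <_) k≡R (subst (r <_) (sym (charge≡ r P v))
              (subst (λ c → r < r + c) (sym cost≡) (m<m+n r (s≤s z≤n))))
  ...   | c₀ , P∈ , c₀≤r
    with explored P∈ (∈-allFin v) (≤-trans (charge-mono P v c₀≤r) (≤-reflexive k≡R))
  ...     | c , S∈ = c , S∈ , ≤-trans (proj₁ (proj₂ (sound' S∈))) (≤-reflexive (sym k≡R))

  advance : ∀ {R C₀ C'} → 1 ≤ R → Complete R C₀ → Sound R C' → C₀ ⊆ᴸ C' →
    (∀ {p} → p ∈ᴸ C₀ → AllExplored R p C') → Complete (suc R) C'
  advance {R} 1≤R complete₀ sound' C₀⊆C' explored {k = k} d k<1+R with k <? R
  ... | yes k<R with complete₀ d k<R
  ...   | c , S∈ , c≤k = c , C₀⊆C' S∈ , c≤k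
  advance 1≤R complete₀ sound' C₀⊆C' explored {k = k} d k<1+R | no k≮R =
    recorded-at-bound 1≤R complete₀ sound' explored d (≤-antisym (≤-pred k<1+R) (≮⇒≥ k≮R))

  sound-weaken : ∀ {R C} → Sound R C → Sound (suc R) C
  sound-weaken sound p∈ with sound p∈
  ... | coverable , r≤R , S≢⊤ = coverable , ≤-trans r≤R (n≤1+n _) , S≢⊤

  -- Since no recorded state is ⊤, every way of reaching ⊤ has charge at least R.
  ⊤-late : ∀ {R C k} → Sound R C → Complete R C → Reachable ⊤ k → R ≤ k
  ⊤-late {R} {k = k} sound complete d with k <? R
  ... | no k≮R = ≮⇒≥ k≮R
  ... | yes k<R with complete d k<R
  ...   | _ , ⊤∈ , _ = contradiction refl (proj₂ (proj₂ (sound ⊤∈)))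

  -- The main loop returns a value that is achievable and not larger than any way of
  -- reaching ⊤; the fuel suffices because ⊤ is reachable with charge at most n.
  wavefront-loop : ∀ fuel {R C k₀} → Sound R C → Complete R C → 1 ≤ R → n < R + fuel →
    Reachable ⊤ k₀ → k₀ ≤ n →
    ∃ λ r → wfLoop G fuel R C ≡ just r × Coverable ⊤ r × (∀ {k} → Reachable ⊤ k → r ≤ k)
  wavefront-loop zero {R} sound complete _ n<R d₀ k₀≤n =
    contradiction (≤-trans (⊤-late sound complete d₀) k₀≤n) (<⇒≱ (subst (n <_) (+-identityʳ R) n<R))
  wavefront-loop (suc fuel) {R} {C} sound complete 1≤R n<R+fuel d₀ k₀≤n
    with wfRound G R C | round-spec R sound
  ... | inj₂ r | coverable , r≤R = r , refl , coverable , λ d → ≤-trans r≤R (⊤-late sound complete d)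
  ... | inj₁ C' | sound' , C⊆C' , explored =
    wavefront-loop fuel (sound-weaken sound') (advance 1≤R complete sound' C⊆C' explored) (s≤s z≤n)
      (subst (n <_) (+-suc R fuel) n<R+fuel) d₀ k₀≤n

  ⊤⊆⇒zfs : ∀ {F} → ⊤ ⊆ cl G F → IsZeroForcingSet G F
  ⊤⊆⇒zfs ⊤⊆ = ⊆-antisym (λ _ → ∈⊤) ⊤⊆

  zfs⇒⊤⊆ : ∀ {F} → IsZeroForcingSet G F → ⊤ ⊆ cl G F
  zfs⇒⊤⊆ zfs {x} _ = subst (x ∈_) (sym zfs) ∈⊤

  -- A coverable size that bounds from below every way of reaching ⊤ is Z(G): it is the
  -- size of a zero forcing set, and every zero forcing set reaches ⊤ within its size.
  zero-forcing-number : ∀ {r} → Coverable ⊤ r → (∀ {k} → Reachable ⊤ k → r ≤ k) →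
    IsZeroForcingNumber G r
  zero-forcing-number {r} (F , ∣F∣≤r , ⊤⊆clF) optimal =
    (F , ⊤⊆⇒zfs ⊤⊆clF , ≤-antisym ∣F∣≤r (lower-bound F (⊤⊆⇒zfs ⊤⊆clF))) , lower-bound
    where
      lower-bound : ∀ S → IsZeroForcingSet G S → r ≤ ∣ S ∣
      lower-bound S zfs =
        let (k , d , k≤∣S∣) = zfs-reachable (zfs⇒⊤⊆ zfs) in ≤-trans (optimal d) k≤∣S∣

theorem1 : (n : ℕ) → 0 < n → (G : Graph n) →
    Σ ℕ (λ k → wavefront G ≡ just k × IsZeroForcingNumber G k)
theorem1 (suc m) _ G =
  let (k₀ , d₀ , k₀≤∣⊤∣) = zfs-reachable G {F = ⊤} (cl-extensive G)
      (r , returns , coverable , optimal) = wavefront-loop G (suc m) initial-sound initial-complete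
        ≤-refl ≤-refl d₀ (≤-trans k₀≤∣⊤∣ (∣p∣≤n ⊤))
  in r , returns , zero-forcing-number G coverable optimal
  where
    initial-sound : Sound G 1 [ (⊥ , 0) ]
    initial-sound (here refl) = (⊥ , ≤-reflexive (∣⊥∣≡0 (suc m)) , ⊥⊆) , z≤n , λ ()
    initial-complete : Complete G 1 [ (⊥ , 0) ]
    initial-complete d k<1 = 0 , here (cong (_, 0) (reachable-0 G d (n<1⇒n≡0 k<1))) , z≤n
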